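{- Let $\gamma\colon X\to CX$ be a cellular automaton, $x\in X$ and $f\in I^{\gamma_1(x)}$. Then for all $c\in X^*$ with $c\circ\gamma_1(x)\circ i=f$ and all $s\in S$: $\gamma_2(x)(f)=s$ if and only if $(\gamma,x,c)\models\big(\bigwedge_{n\in N}\langle n\rangle f(n)\big)\to\bigcirc s$.
   Context: Fix a monoid $(M,\cdot,e)$, a subset $N\subseteq M$ with inclusion $i\colon N\hookrightarrow M$, and a set $S$ of states. $[A,B]$ is the set of maps $A\to B$. For $a\colon M\to X$ let $I^a\subseteq[N,S]$ be the set of $f\colon N\to S$ with $f(n)=f(n')$ whenever $a(i(n))=a(i(n'))$; for $h\colon X\to Y$, $I^{h\circ a}\subseteq I^a$. Let $CX=\coprod_{a\colon M\to X}[I^a,S]$, $(Ch)(a,f)=(h\circ a, f|_{I^{h\circ a}})$. A cellular automaton is $\gamma\colon X\to CX$, $\gamma(x)=(\gamma_1(x),\gamma_2(x))$ with $\gamma_1(x)\colon M\to X$, $\gamma_2(x)\colon I^{\gamma_1(x)}\to S$, such that $\gamma_1(x)(e)=x$ and $\gamma_1(\gamma_1(x)(m))(n)=\gamma_1(x)(n\cdot m)$. Configurations $X^*=[X,S]$. Global rule $G_\gamma(c)(x)=\gamma_2(x)(c\circ\gamma_1(x)\circ i)$. Modal formulas: $\varphi::=s\mid\neg\varphi\mid\bigvee_{j\in J}\varphi_j\mid\langle m\rangle\varphi\mid\bigcirc\varphi$ ($s\in S$, $m\in M$, $J$ arbitrary index set), with abbreviations $\bigwedge_{j}\varphi_j:=\neg\bigvee_j\neg\varphi_j$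 and $\varphi\to\psi:=\neg\varphi\vee\psi$. Semantics: $(\gamma,x,c)\models s$ iff $c(x)=s$; $\neg,\bigvee$ classical; $(\gamma,x,c)\models\langle m\rangle\varphi$ iff $(\gamma,\gamma_1(x)(m),c)\models\varphi$; $(\gamma,x,c)\models\bigcirc\varphi$ iff $(\gamma,x,G_\gamma(c))\models\varphi$. -}

module Defs where

open import Level using (Level; suc; _⊔_) renaming (zero to 0ℓ)
open import Data.Product using (Σ; _,_; proj₁; proj₂)
open import Data.Bool using (Bool; true; false)
open import Data.Empty using (⊥)
open import Relation.Nullary using (¬_)
open import Relation.Binary.PropositionalEquality using (_≡_; cong)
open import Function using (_∘_; Injective)

-- The standing data: a monoid (M,·,e), a subset N ⊆ M given with its
-- (injective) inclusion i : N → M, and a set S of states.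
record Setting : Set₁ where
  field
    M        : Set
    _·_      : M → M → M
    e        : M
    ·-assoc  : ∀ a b c → (a · b) · c ≡ a · (b · c)
    ·-idˡ    : ∀ a → e · a ≡ a
    ·-idʳ    : ∀ a → a · e ≡ a
    N        : Set
    i        : N → M
    i-inj    : Injective _≡_ _≡_ i
    S        : Set

module _ (𝓢 : Setting) where
  open Setting 𝓢

  -- I^a ⊆ [N,S]: maps f : N → S constant on the fibres of a ∘ i.
  -- The membership proof is irrelevant (I^a is a subset, not a structure).
  record I {X : Set} (a : M → X) : Set where
    constructor _⟨_⟩
    field
      fun  : N → S
      .resp : ∀ n n' → a (i n) ≡ a (i n') → fun n ≡ fun n'
  open I public

  C : Set → Set
  C X = Σ (M → X) (λ a → I a → S)

  record CellularAutomaton (X : Set) : Set where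
    field
      γ       : X → C X
    γ₁ : X → M → X
    γ₁ x = proj₁ (γ x)
    γ₂ : (x : X) → I (γ₁ x) → S
    γ₂ x = proj₂ (γ x)
    field
      γ₁-e : ∀ x → γ₁ x e ≡ x
      γ₁-· : ∀ x m n → γ₁ (γ₁ x m) n ≡ γ₁ x (n · m)
  open CellularAutomaton public

  Config : Set → Set
  Config X = X → S

  restrict : {X : Set} (γ : CellularAutomaton X) (c : Config X) (x : X) → I (γ₁ γ x)
  restrict γ c x = record { fun = c ∘ γ₁ γ x ∘ i ; resp = λ n n' eq → cong c eq }

  G : {X : Set} → CellularAutomaton X → Config X → Config X
  G γ c x = γ₂ γ x (restrict γ c x)

  data Formula : Set₁ where
    st   : S → Formula
    ¬'_  : Formula → Formula
    ⋁    : (J : Set) → (J → Formula) → Formula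
    ⟨_⟩_ : M → Formula → Formula
    ○_   : Formula → Formula

  ⋀ : (J : Set) → (J → Formula) → Formula
  ⋀ J φ = ¬' ⋁ J (λ j → ¬' φ j)

  _∨'_ : Formula → Formula → Formula
  φ ∨' ψ = ⋁ Bool (λ { true → φ ; false → ψ })

  _⇒'_ : Formula → Formula → Formula
  φ ⇒' ψ = (¬' φ) ∨' ψ

  _,_,_⊨_ : {X : Set} → CellularAutomaton X → X → Config X → Formula → Set
  γ , x , c ⊨ st s      = c x ≡ s
  γ , x , c ⊨ (¬' φ)    = ¬ (γ , x , c ⊨ φ)
  γ , x , c ⊨ ⋁ J φ     = Σ J (λ j → γ , x , c ⊨ φ j)
  γ , x , c ⊨ (⟨ m ⟩ φ) = γ , γ₁ γ x m , c ⊨ φ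
  γ , x , c ⊨ (○ φ)     = γ , x , G γ c ⊨ φ

{-# OPTIONS --safe #-}
module Submission where

open import Defs
open import Data.Product using (_×_; _,_)
open import Data.Bool using (true; false)
open import Data.Empty using (⊥-elim)
open import Relation.Binary.PropositionalEquality using (_≡_; refl; cong; cong-app; trans; sym)
open import Function using (_∘_)

-- Once c agrees with f on the neighbourhood of x, the antecedent holds and the
-- global rule at x is literally γ₂(x)(f), so the implication reduces to ○ s.

module _ {𝓢 : Setting} where
  open Setting 𝓢

  I-≡ : {X : Set} {a : M → X} (f g : I 𝓢 a) → fun f ≡ fun g → f ≡ g
  I-≡ (F ⟨ _ ⟩) (.F ⟨ _ ⟩) refl = refl

  G-≡-γ₂ : {X : Set} (γ : CellularAutomaton 𝓢 X) (x : X) (f : I 𝓢 (γ₁ γ x)) (c : Config 𝓢 X) →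
           c ∘ γ₁ γ x ∘ i ≡ fun f → G 𝓢 γ c x ≡ γ₂ γ x f
  G-≡-γ₂ γ x f c c≗f = cong (γ₂ γ x) (I-≡ (restrict 𝓢 γ c x) f c≗f)

  ⊨-neighbourhood : {X : Set} (γ : CellularAutomaton 𝓢 X) (x : X) (f : I 𝓢 (γ₁ γ x)) (c : Config 𝓢 X) →
                    c ∘ γ₁ γ x ∘ i ≡ fun f → _,_,_⊨_ 𝓢 γ x c (⋀ 𝓢 N (λ n → ⟨ i n ⟩ st (fun f n)))
  ⊨-neighbourhood γ x f c c≗f (n , c≢f) = c≢f (cong-app c≗f n)

  module _ {X : Set} {γ : CellularAutomaton 𝓢 X} {x : X} {c : Config 𝓢 X} where

    ⊨-⇒-introʳ : {φ ψ : Formula 𝓢} → _,_,_⊨_ 𝓢 γ x c ψ → _,_,_⊨_ 𝓢 γ x c (_⇒'_ 𝓢 φ ψ)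
    ⊨-⇒-introʳ ⊨ψ = false , ⊨ψ

    ⊨-⇒-elim : {φ ψ : Formula 𝓢} →
               _,_,_⊨_ 𝓢 γ x c (_⇒'_ 𝓢 φ ψ) → _,_,_⊨_ 𝓢 γ x c φ → _,_,_⊨_ 𝓢 γ x c ψ
    ⊨-⇒-elim (true  , ⊭φ) ⊨φ = ⊥-elim (⊭φ ⊨φ)
    ⊨-⇒-elim (false , ⊨ψ) _  = ⊨ψ

lemma10 : (𝓢 : Setting) → let open Setting 𝓢 in
    {X : Set} (γ : CellularAutomaton 𝓢 X) (x : X) (f : I 𝓢 (γ₁ γ x)) →
    (c : Config 𝓢 X) → c ∘ γ₁ γ x ∘ i ≡ fun f → (s : S) →
    let φ = _⇒'_ 𝓢 (⋀ 𝓢 N (λ n → ⟨ i n ⟩ st (fun f n))) (○ st s) in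
    (γ₂ γ x f ≡ s → _,_,_⊨_ 𝓢 γ x c φ) × (_,_,_⊨_ 𝓢 γ x c φ → γ₂ γ x f ≡ s)
lemma10 𝓢 γ x f c c≗f s =
    (λ γ₂f≡s → ⊨-⇒-introʳ (trans Gcx≡γ₂f γ₂f≡s))
  , (λ ⊨φ → trans (sym Gcx≡γ₂f) (⊨-⇒-elim ⊨φ (⊨-neighbourhood γ x f c c≗f)))
  where
  Gcx≡γ₂f : G 𝓢 γ c x ≡ γ₂ γ x f
  Gcx≡γ₂f = G-≡-γ₂ γ x f c c≗f
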